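{- For integers $k \geq 0$ and $0 \le n \le k$, let $a_{k,n} = (-2)^k + 2^n$. Let $0 \le n \le k_1$ and $0 \le m \le k_2$ with $(k_1,n) \neq (k_2,m)$. Then $a_{k_1,n} = a_{k_2,m}$ if and only if $k_1$ and $k_2$ are both odd, $n = k_1$ and $m = k_2$. -}

module Defs where

open import Data.Nat using (ℕ; suc; _*_)
open import Data.Integer using (ℤ; +_; -[1+_]) renaming (_+_ to _+ℤ_; _^_ to _^ℤ_)
open import Data.Product using (∃)
open import Relation.Binary.PropositionalEquality using (_≡_)

a : ℕ → ℕ → ℤ
a k n = (-[1+ 1 ] ^ℤ k) +ℤ ((+ 2) ^ℤ n)

Odd : ℕ → Set
Odd k = ∃ λ j → k ≡ suc (2 * j)

-- By parity, (-2)^k is 2^k or -2^k, so an equation a(k₁,n) = a(k₂,m) becomes an equation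
-- between sums of powers of two. When the signs differ, the single power 2^m ≤ 2^k₂ would have
-- to equal a sum exceeding 2^k₂. When both k's are even, 2^k₁ + 2^n = 2^k₂ + 2^m and a sum of
-- two powers of two determines its exponents as an unordered pair; with n ≤ k₁ and m ≤ k₂ this
-- forces (k₁,n) = (k₂,m). When both are odd, 2^n + 2^k₂ = 2^m + 2^k₁, and excluding
-- (k₁,n) = (k₂,m) leaves exactly n = k₁ and m = k₂.
module Submission where

open import Defs
open import Data.Nat using (ℕ; _≤_; _<_; zero; suc; _+_; _*_; _^_)
open import Data.Nat.Properties
open import Data.Integer using (+_; -[1+_]; -_; 0ℤ) renaming (_+_ to _+ℤ_; _*_ to _*ℤ_; _^_ to _^ℤ_)
import Data.Integer.Properties as ℤ
open import Data.Integer.Solver using (module +-*-Solver)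
open import Data.Product using (_×_; _,_; ∃)
open import Data.Sum using (_⊎_; inj₁; inj₂)
open import Data.Empty using (⊥-elim)
open import Function.Bundles using (_⇔_; mk⇔)
open import Relation.Nullary using (¬_)
open import Relation.Binary.PropositionalEquality

Even : ℕ → Set
Even k = ∃ λ j → k ≡ 2 * j

parity : ∀ k → Even k ⊎ Odd k
parity zero = inj₁ (0 , refl)
parity (suc k) with parity k
... | inj₁ (j , refl) = inj₂ (j , refl)
... | inj₂ (j , refl) = inj₁ (suc j , sym (*-suc 2 j))

2^-injective : ∀ {a b} → 2 ^ a ≡ 2 ^ b → a ≡ b
2^-injective {zero}  {zero}  _  = refl
2^-injective {zero}  {suc b} eq = ⊥-elim (even≢odd (2 ^ b) 0 (sym eq))
2^-injective {suc a} {zero}  eq = ⊥-elim (even≢odd (2 ^ a) 0 eq)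
2^-injective {suc a} {suc b} eq = cong suc (2^-injective (*-cancelˡ-≡ _ _ 2 eq))

SamePair : ℕ → ℕ → ℕ → ℕ → Set
SamePair a b c d = (a ≡ c × b ≡ d) ⊎ (a ≡ d × b ≡ c)

module SamePair where

  swapˡ : ∀ {a b c d} → SamePair b a c d → SamePair a b c d
  swapˡ (inj₁ (p , q)) = inj₂ (q , p)
  swapˡ (inj₂ (p , q)) = inj₁ (q , p)

  swapʳ : ∀ {a b c d} → SamePair a b d c → SamePair a b c d
  swapʳ (inj₁ (p , q)) = inj₂ (p , q)
  swapʳ (inj₂ (p , q)) = inj₁ (p , q)

  symmetric : ∀ {a b c d} → SamePair c d a b → SamePair a b c d
  symmetric (inj₁ (p , q)) = inj₁ (sym p , sym q)
  symmetric (inj₂ (p , q)) = inj₂ (sym q , sym p)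

  suc⁺ : ∀ {a b c d} → SamePair a b c d → SamePair (suc a) (suc b) (suc c) (suc d)
  suc⁺ (inj₁ (p , q)) = inj₁ (cong suc p , cong suc q)
  suc⁺ (inj₂ (p , q)) = inj₂ (cong suc p , cong suc q)

-- Apart from 1 + 2⁰ = 2 < 2^(c+1) + 2^(d+1), parity decides: 2 ^ suc c reduces to 2 * 2 ^ c.
1+2^b≡2^c+2^d⇒SamePair : ∀ b c d → 1 + 2 ^ b ≡ 2 ^ c + 2 ^ d → SamePair 0 b c d
1+2^b≡2^c+2^d⇒SamePair b zero d eq = inj₁ (refl , 2^-injective (+-cancelˡ-≡ 1 _ _ eq))
1+2^b≡2^c+2^d⇒SamePair b (suc c) zero eq =
  inj₂ (refl , 2^-injective (+-cancelˡ-≡ 1 _ _ (trans eq (+-comm (2 ^ suc c) 1))))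
1+2^b≡2^c+2^d⇒SamePair zero (suc c) (suc d) eq =
  ⊥-elim (<-irrefl eq (+-mono-< (*-monoʳ-≤ 2 (m^n>0 2 c)) (*-monoʳ-≤ 2 (m^n>0 2 d))))
1+2^b≡2^c+2^d⇒SamePair (suc b) (suc c) (suc d) eq =
  ⊥-elim (even≢odd (2 ^ c + 2 ^ d) (2 ^ b) (sym (trans eq (sym (*-distribˡ-+ 2 (2 ^ c) (2 ^ d))))))

2^+2^-injective : ∀ a b c d → 2 ^ a + 2 ^ b ≡ 2 ^ c + 2 ^ d → SamePair a b c d
2^+2^-injective zero b c d eq = 1+2^b≡2^c+2^d⇒SamePair b c d eq
2^+2^-injective (suc a) zero c d eq =
  SamePair.swapˡ (1+2^b≡2^c+2^d⇒SamePair (suc a) c d (trans (+-comm 1 (2 ^ suc a)) eq))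
2^+2^-injective (suc a) (suc b) zero d eq =
  SamePair.symmetric (1+2^b≡2^c+2^d⇒SamePair d (suc a) (suc b) (sym eq))
2^+2^-injective (suc a) (suc b) (suc c) zero eq =
  SamePair.swapʳ (SamePair.symmetric
    (1+2^b≡2^c+2^d⇒SamePair (suc c) (suc a) (suc b) (sym (trans eq (+-comm (2 ^ suc c) 1)))))
2^+2^-injective (suc a) (suc b) (suc c) (suc d) eq =
  SamePair.suc⁺ (2^+2^-injective a b c d (*-cancelˡ-≡ _ _ 2 (begin
    2 * (2 ^ a + 2 ^ b)   ≡⟨ *-distribˡ-+ 2 (2 ^ a) (2 ^ b) ⟩
    2 ^ suc a + 2 ^ suc b ≡⟨ eq ⟩
    2 ^ suc c + 2 ^ suc d ≡⟨ *-distribˡ-+ 2 (2 ^ c) (2 ^ d) ⟨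
    2 * (2 ^ c + 2 ^ d)   ∎)))
  where open ≡-Reasoning

sorted-2^+2^-injective : ∀ {k l n m} → n ≤ k → m ≤ l →
                         2 ^ k + 2 ^ n ≡ 2 ^ l + 2 ^ m → k ≡ l × n ≡ m
sorted-2^+2^-injective {k} {l} {n} {m} n≤k m≤l eq with 2^+2^-injective k n l m eq
... | inj₁ k≡l×n≡m = k≡l×n≡m
... | inj₂ (k≡m , n≡l) = k≡l , trans n≡l (trans (sym k≡l) k≡m)
  where
  k≡l : k ≡ l
  k≡l = ≤-antisym (subst (_≤ l) (sym k≡m) m≤l) (subst (_≤ k) n≡l n≤k)

2^m<2^k+2^n+2^l : ∀ k n {l m} → m ≤ l → 2 ^ m < 2 ^ k + 2 ^ n + 2 ^ l
2^m<2^k+2^n+2^l k n {l} {m} m≤l = begin-strict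
  2 ^ m                 ≤⟨ ^-monoʳ-≤ 2 m≤l ⟩
  2 ^ l                 <⟨ m<n+m (2 ^ l) (<-≤-trans (m^n>0 2 k) (m≤m+n (2 ^ k) (2 ^ n))) ⟩
  2 ^ k + 2 ^ n + 2 ^ l ∎
  where open ≤-Reasoning

pos-^ : ∀ m n → + (m ^ n) ≡ (+ m) ^ℤ n
pos-^ m zero    = refl
pos-^ m (suc n) = trans (ℤ.pos-* m (m ^ n)) (cong (+ m *ℤ_) (pos-^ m n))

-2^-even : ∀ {k} → Even k → -[1+ 1 ] ^ℤ k ≡ + (2 ^ k)
-2^-even (j , refl) = begin
  -[1+ 1 ] ^ℤ (2 * j)   ≡⟨ ℤ.^-*-assoc -[1+ 1 ] 2 j ⟨
  (+ 4) ^ℤ j            ≡⟨ pos-^ 4 j ⟨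
  + (4 ^ j)             ≡⟨ cong +_ (^-*-assoc 2 2 j) ⟩
  + (2 ^ (2 * j))       ∎
  where open ≡-Reasoning

-2^-odd : ∀ {k} → Odd k → -[1+ 1 ] ^ℤ k ≡ - + (2 ^ k)
-2^-odd (j , refl) = begin
  - (+ 2) *ℤ -[1+ 1 ] ^ℤ (2 * j)   ≡⟨ cong (- (+ 2) *ℤ_) (-2^-even (j , refl)) ⟩
  - (+ 2) *ℤ + (2 ^ (2 * j))       ≡⟨ ℤ.neg-distribˡ-* (+ 2) (+ (2 ^ (2 * j))) ⟨
  - (+ 2 *ℤ + (2 ^ (2 * j)))       ≡⟨ cong -_ (ℤ.pos-* 2 (2 ^ (2 * j))) ⟨
  - + (2 ^ suc (2 * j))            ∎
  where open ≡-Reasoning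

a-even : ∀ {k} n → Even k → a k n ≡ + (2 ^ k + 2 ^ n)
a-even n e = cong₂ _+ℤ_ (-2^-even e) (sym (pos-^ 2 n))

a-odd : ∀ {k} n → Odd k → a k n ≡ - + (2 ^ k) +ℤ + (2 ^ n)
a-odd n o = cong₂ _+ℤ_ (-2^-odd o) (sym (pos-^ 2 n))

module _ where
  open +-*-Solver

  -x+y≡-z+w⇒y+z≡w+x : ∀ x y z w → - x +ℤ y ≡ - z +ℤ w → y +ℤ z ≡ w +ℤ x
  -x+y≡-z+w⇒y+z≡w+x x y z w eq = begin
    y +ℤ z                  ≡⟨ solve 3 (λ x y z → y :+ z := (:- x :+ y) :+ (x :+ z)) refl x y z ⟩
    (- x +ℤ y) +ℤ (x +ℤ z)  ≡⟨ cong (_+ℤ (x +ℤ z)) eq ⟩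
    (- z +ℤ w) +ℤ (x +ℤ z)  ≡⟨ solve 3 (λ x z w → (:- z :+ w) :+ (x :+ z) := w :+ x) refl x z w ⟩
    w +ℤ x                  ∎
    where open ≡-Reasoning

  x≡-z+w⇒x+z≡w : ∀ x z w → x ≡ - z +ℤ w → x +ℤ z ≡ w
  x≡-z+w⇒x+z≡w x z w eq = begin
    x +ℤ z             ≡⟨ cong (_+ℤ z) eq ⟩
    (- z +ℤ w) +ℤ z    ≡⟨ solve 2 (λ z w → (:- z :+ w) :+ z := w) refl z w ⟩
    w                  ∎
    where open ≡-Reasoning

a-even≢a-odd : ∀ {k₁ k₂} n m → m ≤ k₂ → Even k₁ → Odd k₂ → a k₁ n ≢ a k₂ m
a-even≢a-odd {k₁} {k₂} n m m≤k₂ e o eq =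
  <-irrefl (sym (ℤ.+-injective (x≡-z+w⇒x+z≡w (+ (2 ^ k₁ + 2 ^ n)) (+ (2 ^ k₂)) (+ (2 ^ m)) a-eq))) (2^m<2^k+2^n+2^l k₁ n m≤k₂)
  where
  a-eq : + (2 ^ k₁ + 2 ^ n) ≡ - + (2 ^ k₂) +ℤ + (2 ^ m)
  a-eq = trans (sym (a-even n e)) (trans eq (a-odd m o))

a-odd-diagonal : ∀ {k} → Odd k → a k k ≡ 0ℤ
a-odd-diagonal {k} o = trans (a-odd k o) (ℤ.+-inverseˡ (+ (2 ^ k)))

lemma3 : (k₁ k₂ n m : ℕ) → n ≤ k₁ → m ≤ k₂ → ¬ ((k₁ ≡ k₂) × (n ≡ m)) →
    (a k₁ n ≡ a k₂ m) ⇔ (Odd k₁ × Odd k₂ × n ≡ k₁ × m ≡ k₂)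
lemma3 k₁ k₂ n m n≤k₁ m≤k₂ distinct = mk⇔ to from
  where
  to : a k₁ n ≡ a k₂ m → Odd k₁ × Odd k₂ × n ≡ k₁ × m ≡ k₂
  to eq with parity k₁ | parity k₂
  ... | inj₁ e₁ | inj₁ e₂ = ⊥-elim (distinct (sorted-2^+2^-injective n≤k₁ m≤k₂
          (ℤ.+-injective (trans (sym (a-even n e₁)) (trans eq (a-even m e₂))))))
  ... | inj₁ e₁ | inj₂ o₂ = ⊥-elim (a-even≢a-odd n m m≤k₂ e₁ o₂ eq)
  ... | inj₂ o₁ | inj₁ e₂ = ⊥-elim (a-even≢a-odd m n n≤k₁ e₂ o₁ (sym eq))
  ... | inj₂ o₁ | inj₂ o₂
    with 2^+2^-injective n k₂ m k₁ (ℤ.+-injective (-x+y≡-z+w⇒y+z≡w+x (+ (2 ^ k₁)) (+ (2 ^ n)) (+ (2 ^ k₂)) (+ (2 ^ m))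
           (trans (sym (a-odd n o₁)) (trans eq (a-odd m o₂)))))
  ... | inj₁ (n≡m , k₂≡k₁) = ⊥-elim (distinct (sym k₂≡k₁ , n≡m))
  ... | inj₂ (n≡k₁ , k₂≡m) = o₁ , o₂ , n≡k₁ , sym k₂≡m

  from : Odd k₁ × Odd k₂ × n ≡ k₁ × m ≡ k₂ → a k₁ n ≡ a k₂ m
  from (o₁ , o₂ , refl , refl) = trans (a-odd-diagonal o₁) (sym (a-odd-diagonal o₂))
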